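{- Let $n\geq3$ and $k\geq 3$. Let $X_k(n-1)$ be any set of edges of $B_k(n-1)$ obtained as the union of $E_k(n-1)$ with the edge sets of exactly one circuit from each reverse-complementary pair of non-negasymmetric circuits in $\mathcal{C}_k(n-1)$. Then $D^{ -1}(X_k(n-1))=\{\mathbf{a}\in\mathbb{Z}_k^{n+1}: D(\mathbf{a})\in X_k(n-1)\}$ is the set of edges of a connected subgraph of $B_k(n)$.
   Context: Tuples are $k$-ary (entries in $\mathbb{Z}_k$), negation is modulo $k$, $\mathbf{u}^R$ is the reverse of $\mathbf{u}$. The pseudoweight of $a\in\mathbb{Z}_k$ is $a$ if $a\ne0$ and $k/2$ if $a=0$, and of a tuple the sum over its entries. For $N\ge2$, $B_k(N-1)$ is the de Bruijn digraph with vertices the $k$-ary $(N-1)$-tuples and edges the $k$-ary $N$-tuples $(a_0,\dots,a_{N-1})$ from $(a_0,\dots,a_{N-2})$ to $(a_1,\dots,a_{N-1})$. $E_k(n-1)$ is the set of edges of $B_k(n-1)$ of pseudoweight less than $kn/2$; $H_k(n-1)$ is the subgraph with edges of pseudoweight exactly $kn/2$. For an $n$-tuple $(a_0,\dots,a_{n-1})$, with $p$ the least positive $c$ such that $a_i=a_{(i+c)\bmod n}$ for all $i$, $[a_0,\dots,a_{n-1}]$ is the circuit whose edges are the $p$ cyclic shifts $(a_j,\dots,a_{j+n-1})$ (indices mod $n$), $0\le j<p$. $\mathcal{C}_k(n-1)$ is the set of such circuits arising from edges of $H_k(n-1)$. A circuit is negasymmetric if it contains edges $\mathbf a,\mathbf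 b$ (not necessarily distinct) with $\mathbf a=-\mathbf b^R$, non-negasymmetric otherwise; a non-negasymmetric $[a_0,\dots,a_{n-1}]\in\mathcal{C}_k(n-1)$ and the (distinct, non-negasymmetric) circuit $[-a_{n-1},\dots,-a_0]$ form a reverse-complementary pair. The Lempel map $D:\mathbb{Z}_k^{n+1}\to\mathbb{Z}_k^{n}$ is $D(a_0,\dots,a_n)=(a_1-a_0,a_2-a_1,\dots,a_n-a_{n-1})$ (mod $k$). A set of edges of $B_k(n)$ is the edge set of a connected subgraph if the subgraph consisting of these edges and their incident vertices is (weakly) connected. -}

module Defs where

open import Data.Nat using (ℕ; zero; suc; _+_; _*_; _<_; _≤_)
open import Data.Nat.DivMod using (_%_; m%n<n)
open import Data.Fin using (Fin; zero; suc; toℕ; fromℕ<)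
open import Data.Vec using (Vec; []; _∷_; _∷ʳ_; reverse; map; init; tail)
open import Data.Product using (Σ; ∃; _×_; _,_)
open import Data.Sum using (_⊎_)
open import Relation.Nullary using (¬_)
open import Relation.Binary.PropositionalEquality using (_≡_)

Tuple : ℕ → ℕ → Set
Tuple k N = Vec (Fin k) N

negₖ : {k : ℕ} → Fin k → Fin k
negₖ {suc m} a = fromℕ< (m%n<n (suc m ∸' toℕ a) (suc m))
  where
  _∸'_ : ℕ → ℕ → ℕ
  x ∸' zero = x
  zero ∸' suc y = zero
  suc x ∸' suc y = x ∸' y

subₖ : {k : ℕ} → Fin k → Fin k → Fin k
subₖ {suc m} a b = fromℕ< (m%n<n (toℕ a + toℕ (negₖ b)) (suc m))

negT : {k N : ℕ} → Tuple k N → Tuple k N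
negT = map negₖ

-- twice the pseudoweight of an entry: 2a if a ≠ 0, k if a = 0
pw2 : {k : ℕ} → Fin k → ℕ
pw2 {k} zero = k
pw2 (suc i) = 2 * suc (toℕ i)

pw2T : {k N : ℕ} → Tuple k N → ℕ
pw2T [] = 0
pw2T (x ∷ xs) = pw2 x + pw2T xs

-- E_k(n-1): n-tuples with pseudoweight < kn/2, i.e. 2·pw < kn
InE : {k n : ℕ} → Tuple k n → Set
InE {k} {n} a = pw2T a < k * n

-- edges of H_k(n-1): pseudoweight exactly kn/2, i.e. 2·pw = kn
InH : {k n : ℕ} → Tuple k n → Set
InH {k} {n} a = pw2T a ≡ k * n

rot1 : {A : Set} {N : ℕ} → Vec A N → Vec A N
rot1 [] = []
rot1 (x ∷ xs) = xs ∷ʳ x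

rot : {A : Set} {N : ℕ} → ℕ → Vec A N → Vec A N
rot zero a = a
rot (suc j) a = rot j (rot1 a)

-- e is an edge of the circuit [a] (the set of cyclic shifts of a)
EdgeOf : {k n : ℕ} → Tuple k n → Tuple k n → Set
EdgeOf {n = n} e a = Σ ℕ λ j → j < n × e ≡ rot j a

Negasym : {k n : ℕ} → Tuple k n → Set
Negasym a = Σ _ λ b → Σ _ λ c → EdgeOf b a × EdgeOf c a × b ≡ negT (reverse c)

rc : {k n : ℕ} → Tuple k n → Tuple k n
rc a = negT (reverse a)

-- A selection of circuits is given by a set Sel of generating tuples; the
-- selected circuits are the [c] with c ∈ Sel.  [a] is selected iff a lies on
-- some selected circuit.
Chosen : {k n : ℕ} → (Tuple k n → Set) → Tuple k n → Set
Chosen Sel a = Σ _ λ c → Sel c × EdgeOf a c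

ValidSelection : {k n : ℕ} → (Tuple k n → Set) → Set
ValidSelection {k} {n} Sel =
  ((c : Tuple k n) → Sel c → InH c × ¬ Negasym c) ×
  ((a : Tuple k n) → InH a → ¬ Negasym a →
     (Chosen Sel a ⊎ Chosen Sel (rc a)) × ¬ (Chosen Sel a × Chosen Sel (rc a)))

X : {k n : ℕ} → (Tuple k n → Set) → Tuple k n → Set
X Sel e = InE e ⊎ Chosen Sel e

D : {k n : ℕ} → Tuple k (suc n) → Tuple k n
D (x ∷ []) = []
D (x ∷ y ∷ xs) = subₖ y x ∷ D (y ∷ xs)

DInv : {k n : ℕ} → (Tuple k n → Set) → Tuple k (suc n) → Set
DInv S a = S (D a)

-- de Bruijn graph B_k(N): edge e (an (N+1)-tuple) goes from init e to tail e
source target : {k N : ℕ} → Tuple k (suc N) → Tuple k N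
source e = init e
target e = tail e

Incident : {k N : ℕ} → (Tuple k (suc N) → Set) → Tuple k N → Set
Incident S u = Σ _ λ e → S e × (source e ≡ u ⊎ target e ≡ u)

data WPath {k N : ℕ} (S : Tuple k (suc N) → Set) : Tuple k N → Tuple k N → Set where
  here : ∀ {u} → WPath S u u
  fwd  : ∀ {v} e → S e → WPath S (target e) v → WPath S (source e) v
  bwd  : ∀ {v} e → S e → WPath S (source e) v → WPath S (target e) v

ConnectedEdgeSet : {k N : ℕ} → (Tuple k (suc N) → Set) → Set
ConnectedEdgeSet S = ∀ u v → Incident S u → Incident S v → WPath S u v

{-# OPTIONS --safe #-}
-- Shifting an edge e = (a₀, …, aₙ) of B_k(n) to (a₁, …, aₙ, aₙ + 1) is a forward step that
-- turns D e = (h, t₁, …, t_{n-1}) into (t₁, …, t_{n-1}, 1).  For k ≥ 3 the entry 1 has the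
-- least pseudoweight, strictly below that of every other entry, so the shift keeps D e in X:
-- an edge of E stays in E, and an edge of a selected circuit of H either falls into E (h ≠ 1)
-- or moves along its circuit (h = 1).  After n shifts every edge is an orbit
-- (c, c + 1, …, c + n), and k − c further shifts reach (0, 1, …, n); so every vertex incident
-- to D⁻¹(X) is joined to (0, 1, …, n − 1).
module Submission where

open import Defs
open import Data.Nat using (ℕ; zero; suc; _+_; _∸_; _≤_; _<_; z≤n; s≤s; NonZero)
open import Data.Nat.Properties
  using (+-comm; +-assoc; +-suc; +-identityʳ; +-monoʳ-≤; +-monoʳ-<; *-monoʳ-≤;
         ≤-reflexive; ≤-trans; n≤1+n; ≤-<-trans; <-≤-trans; m≤n⇒m<n∨m≡n; m+[n∸m]≡n; module ≤-Reasoning)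
open import Data.Nat.DivMod using (_%_; m%n<n; %-distribˡ-+; m%n%n≡m%n; [m+n]%n≡m%n; n%n≡0; m<n⇒m%n≡m)
open import Data.Nat.GeneralisedArithmetic using (iterate)
open import Data.Fin using (Fin; zero; suc; toℕ; fromℕ<; _≟_)
open import Data.Fin.Properties using (toℕ-fromℕ<; toℕ-injective; toℕ<n; toℕ≤n)
open import Data.Vec using (Vec; []; _∷_; _∷ʳ_; last; tail; toList)
import Data.Vec as Vec
open import Data.Vec.Properties using (init-∷ʳ; toList-∷ʳ; toList-injective; length-toList)
open import Data.Vec.Relation.Binary.Equality.Cast using (cast-is-id)
open import Data.List using (List; []; _∷_; _++_; [_]; length)
open import Data.List.Properties using (++-assoc; ++-identityʳ; ∷-injective)
open import Data.Product using (Σ; _,_; proj₁)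
open import Data.Sum using (inj₁; inj₂)
open import Data.Empty using (⊥-elim)
open import Relation.Nullary using (¬_; yes; no)
open import Relation.Binary.PropositionalEquality
  using (_≡_; refl; sym; trans; cong; cong₂; subst; module ≡-Reasoning)

iterate-+ : ∀ {A : Set} (f : A → A) x m n → iterate f x (m + n) ≡ iterate f (iterate f x m) n
iterate-+ f x zero n = refl
iterate-+ f x (suc m) n = iterate-+ f (f x) m n

iterate-commute : ∀ {A B : Set} {f : A → A} {g : B → B} {h : A → B} →
  (∀ x → g (h x) ≡ h (f x)) → ∀ x m → iterate g (h x) m ≡ h (iterate f x m)
iterate-commute comm x zero = refl
iterate-commute {g = g} comm x (suc m) =
  trans (cong (λ y → iterate g y m) (comm x)) (iterate-commute comm _ m)

module ShiftRegister {A : Set} (f : A → A) where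

  shift : ∀ {n} → Vec A (suc n) → Vec A (suc n)
  shift e = tail e ∷ʳ f (last e)

  extend : ∀ {n} → Vec A (suc n) → Vec A (suc (suc n))
  extend r = r ∷ʳ f (last r)

  shift-extend : ∀ {n} (r : Vec A (suc n)) → shift (extend r) ≡ extend (shift r)
  shift-extend (a ∷ r) = refl

  extend-orbit : ∀ c n → extend (Vec.iterate f c (suc n)) ≡ Vec.iterate f c (suc (suc n))
  extend-orbit c zero = refl
  extend-orbit c (suc n) = cong (c ∷_) (extend-orbit (f c) n)

  shift-orbit : ∀ c n → shift (Vec.iterate f c (suc n)) ≡ Vec.iterate f (f c) (suc n)
  shift-orbit c zero = refl
  shift-orbit c (suc n) = extend-orbit (f c) n

  iterate-shift-to-orbit : ∀ {n} (e : Vec A (suc n)) → iterate shift e n ≡ Vec.iterate f (last e) (suc n)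
  iterate-shift-to-orbit (a ∷ []) = refl
  iterate-shift-to-orbit {suc n} (a ∷ r) = begin
    iterate shift (extend r) n              ≡⟨ iterate-commute {h = extend} shift-extend r n ⟩
    extend (iterate shift r n)              ≡⟨ cong extend (iterate-shift-to-orbit r) ⟩
    extend (Vec.iterate f (last r) (suc n)) ≡⟨ extend-orbit (last r) n ⟩
    Vec.iterate f (last r) (suc (suc n))    ∎
    where open ≡-Reasoning

  iterate-shift : ∀ {n} (e : Vec A (suc n)) r →
    iterate shift e (n + r) ≡ Vec.iterate f (iterate f (last e) r) (suc n)
  iterate-shift {n} e r = begin
    iterate shift e (n + r)                          ≡⟨ iterate-+ shift e n r ⟩
    iterate shift (iterate shift e n) r              ≡⟨ cong (λ e′ → iterate shift e′ r) (iterate-shift-to-orbit e) ⟩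
    iterate shift (Vec.iterate f (last e) (suc n)) r ≡⟨ iterate-commute (λ c → shift-orbit c n) (last e) r ⟩
    Vec.iterate f (iterate f (last e) r) (suc n)     ∎
    where open ≡-Reasoning

module _ {k N : ℕ} {S : Tuple k (suc N) → Set} where

  _++ʷ_ : ∀ {u v w} → WPath S u v → WPath S v w → WPath S u w
  here       ++ʷ q = q
  fwd e Se p ++ʷ q = fwd e Se (p ++ʷ q)
  bwd e Se p ++ʷ q = bwd e Se (p ++ʷ q)

  reverseʷ : ∀ {u v} → WPath S u v → WPath S v u
  reverseʷ here         = here
  reverseʷ (fwd e Se p) = reverseʷ p ++ʷ bwd e Se here
  reverseʷ (bwd e Se p) = reverseʷ p ++ʷ fwd e Se here

module Flow {k N : ℕ} (S : Tuple k (suc N) → Set) (step : Tuple k (suc N) → Tuple k (suc N))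
  (S-step : ∀ e → S e → S (step e)) (source-step : ∀ e → source (step e) ≡ target e) where

  walk-iterate : ∀ e m → S e → WPath S (source e) (source (iterate step e m))
  walk-iterate e zero    Se = here
  walk-iterate e (suc m) Se =
    fwd e Se (subst (λ u → WPath S u (source (iterate step e (suc m)))) (source-step e)
                    (walk-iterate (step e) m (S-step e Se)))

  connected-if-flows-to : (w : Tuple k N) → (∀ e → S e → Σ ℕ λ m → source (iterate step e m) ≡ w) →
    ConnectedEdgeSet S
  connected-if-flows-to w flows u v u∈S v∈S = walk-to-w u∈S ++ʷ reverseʷ (walk-to-w v∈S)
    where
    walk-from-source : ∀ e → S e → WPath S (source e) w
    walk-from-source e Se with flows e Se
    ... | m , reaches-w = subst (WPath S (source e)) reaches-w (walk-iterate e m Se)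

    walk-to-w : ∀ {u} → Incident S u → WPath S u w
    walk-to-w (e , Se , inj₁ refl) = walk-from-source e Se
    walk-to-w (e , Se , inj₂ refl) = bwd e Se (walk-from-source e Se)

rot-suc : ∀ {A : Set} {N} j (a : Vec A N) → rot (suc j) a ≡ rot1 (rot j a)
rot-suc zero    a = refl
rot-suc (suc j) a = rot-suc j (rot1 a)

toList-rot-++ : ∀ {A : Set} {N} (a : Vec A N) (xs ys : List A) →
  toList a ≡ xs ++ ys → toList (rot (length xs) a) ≡ ys ++ xs
toList-rot-++ a [] ys a≡ys = trans a≡ys (sym (++-identityʳ ys))
toList-rot-++ (x′ ∷ a) (x ∷ xs) ys x′∷a≡x∷xs++ys with ∷-injective x′∷a≡x∷xs++ys
... | refl , a≡xs++ys = begin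
  toList (rot (length xs) (a ∷ʳ x))   ≡⟨ toList-rot-++ (a ∷ʳ x) xs (ys ++ [ x ]) a∷ʳx≡ ⟩
  (ys ++ [ x ]) ++ xs                 ≡⟨ ++-assoc ys [ x ] xs ⟩
  ys ++ x ∷ xs                        ∎
  where
  open ≡-Reasoning
  a∷ʳx≡ : toList (a ∷ʳ x) ≡ xs ++ ys ++ [ x ]
  a∷ʳx≡ = trans (toList-∷ʳ x a) (trans (cong (_++ [ x ]) a≡xs++ys) (++-assoc xs ys [ x ]))

rot-length : ∀ {A : Set} {N} (a : Vec A N) → rot N a ≡ a
rot-length {N = N} a = trans (sym (cast-is-id refl _)) (toList-injective refl _ _ (begin
  toList (rot N a)                      ≡⟨ cong (λ j → toList (rot j a)) (sym (length-toList a)) ⟩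
  toList (rot (length (toList a)) a)    ≡⟨ toList-rot-++ a (toList a) [] (sym (++-identityʳ _)) ⟩
  toList a                              ∎))
  where open ≡-Reasoning

EdgeOf-rot1 : ∀ {k n} {e c : Tuple k n} → EdgeOf e c → EdgeOf (rot1 e) c
EdgeOf-rot1 {c = c} (j , j<n , refl) with m≤n⇒m<n∨m≡n j<n
... | inj₁ 1+j<n = suc j , 1+j<n , sym (rot-suc j c)
... | inj₂ refl  = 0 , s≤s z≤n , trans (sym (rot-suc j c)) (rot-length c)

Chosen-rot1 : ∀ {k n} {Sel : Tuple k n → Set} {e} → Chosen Sel e → Chosen Sel (rot1 e)
Chosen-rot1 (c , c∈Sel , e∈[c]) = c , c∈Sel , EdgeOf-rot1 e∈[c]

pw2T-∷ʳ : ∀ {k N} (xs : Tuple k N) y → pw2T (xs ∷ʳ y) ≡ pw2T xs + pw2 y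
pw2T-∷ʳ []       y = +-comm (pw2 y) 0
pw2T-∷ʳ (x ∷ xs) y = trans (cong (pw2 x +_) (pw2T-∷ʳ xs y)) (sym (+-assoc (pw2 x) (pw2T xs) (pw2 y)))

pw2T-rot1 : ∀ {k N} (a : Tuple k N) → pw2T (rot1 a) ≡ pw2T a
pw2T-rot1 []       = refl
pw2T-rot1 (x ∷ xs) = trans (pw2T-∷ʳ xs x) (+-comm (pw2T xs) (pw2 x))

pw2T-rot : ∀ {k N} j (a : Tuple k N) → pw2T (rot j a) ≡ pw2T a
pw2T-rot zero    a = refl
pw2T-rot (suc j) a = trans (pw2T-rot j (rot1 a)) (pw2T-rot1 a)

Chosen⇒InH : ∀ {k n} {Sel : Tuple k n → Set} → (∀ c → Sel c → InH c) → ∀ {e} → Chosen Sel e → InH e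
Chosen⇒InH Sel⊆H (c , c∈Sel , j , _ , refl) = trans (pw2T-rot j c) (Sel⊆H c c∈Sel)

module _ {k N : ℕ} (h : Fin k) (t : Tuple k N) {y : Fin k} where
  open ≤-Reasoning

  pw2T-∷ʳ-≤ : pw2 y ≤ pw2 h → pw2T (t ∷ʳ y) ≤ pw2T (h ∷ t)
  pw2T-∷ʳ-≤ y≤h = begin
    pw2T (t ∷ʳ y)  ≡⟨ pw2T-∷ʳ t y ⟩
    pw2T t + pw2 y ≤⟨ +-monoʳ-≤ (pw2T t) y≤h ⟩
    pw2T t + pw2 h ≡⟨ +-comm (pw2T t) (pw2 h) ⟩
    pw2T (h ∷ t)   ∎

  pw2T-∷ʳ-< : pw2 y < pw2 h → pw2T (t ∷ʳ y) < pw2T (h ∷ t)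
  pw2T-∷ʳ-< y<h = begin-strict
    pw2T (t ∷ʳ y)  ≡⟨ pw2T-∷ʳ t y ⟩
    pw2T t + pw2 y <⟨ +-monoʳ-< (pw2T t) y<h ⟩
    pw2T t + pw2 h ≡⟨ +-comm (pw2T t) (pw2 h) ⟩
    pw2T (h ∷ t)   ∎

module _ {q : ℕ} where
  one : Fin (3 + q)
  one = suc zero

  pw2-one-minimal : ∀ (x : Fin (3 + q)) → pw2 one ≤ pw2 x
  pw2-one-minimal zero    = s≤s (s≤s z≤n)
  pw2-one-minimal (suc i) = *-monoʳ-≤ 2 (s≤s z≤n)

  pw2-one-strict-minimum : ∀ (x : Fin (3 + q)) → ¬ x ≡ one → pw2 one < pw2 x
  pw2-one-strict-minimum zero          _   = s≤s (s≤s (s≤s z≤n))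
  pw2-one-strict-minimum (suc zero)    x≢1 = ⊥-elim (x≢1 refl)
  pw2-one-strict-minimum (suc (suc i)) _   = ≤-trans (n≤1+n 3) (*-monoʳ-≤ 2 (s≤s (s≤s z≤n)))

X-shift : ∀ {q n} {Sel : Tuple (3 + q) (suc n) → Set} → (∀ c → Sel c → InH c) →
  ∀ h t → X Sel (h ∷ t) → X Sel (t ∷ʳ one)
X-shift Sel⊆H h t (inj₁ h∷t∈E) = inj₁ (≤-<-trans (pw2T-∷ʳ-≤ h t (pw2-one-minimal h)) h∷t∈E)
X-shift Sel⊆H h t (inj₂ h∷t∈C) with h ≟ one
... | yes refl = inj₂ (Chosen-rot1 h∷t∈C)
... | no h≢1   = inj₁ (<-≤-trans (pw2T-∷ʳ-< h t (pw2-one-strict-minimum h h≢1))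
                                  (≤-reflexive (Chosen⇒InH Sel⊆H h∷t∈C)))

-- negₖ subtracts with a where-bound copy of _∸_ that cannot be named here: `index` exposes the
-- number negₖ passes to fromℕ<, and after `with` abstracts its arguments the type of monus≡∸
-- (which mentions that copy) is left for unification to fill in.
module _ (m : ℕ) (a : Fin (suc m)) where
  private
    index : ∀ {x K} .{p : x < K} → fromℕ< p ≡ fromℕ< p → ℕ
    index {x} _ = x

    index-negₖ : index (refl {x = negₖ a}) ≡ (suc m ∸ toℕ a) % suc m

    monus≡∸ : (x y : ℕ) → _
    monus≡∸ x       zero    = refl
    monus≡∸ zero    (suc y) = refl
    monus≡∸ (suc x) (suc y) = monus≡∸ x y

    index-negₖ with suc m | toℕ a
    ... | x | y = monus≡∸ x y

  toℕ-negₖ : toℕ (negₖ a) ≡ (suc m ∸ toℕ a) % suc m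
  toℕ-negₖ = trans (toℕ-fromℕ< _) index-negₖ

succₖ : ∀ {m} → Fin (suc m) → Fin (suc m)
succₖ {m} x = fromℕ< (m%n<n (suc (toℕ x)) (suc m))

toℕ-succₖ : ∀ {m} (x : Fin (suc m)) → toℕ (succₖ x) ≡ suc (toℕ x) % suc m
toℕ-succₖ x = toℕ-fromℕ< _

toℕ-subₖ : ∀ {m} (x y : Fin (suc m)) → toℕ (subₖ x y) ≡ (toℕ x + toℕ (negₖ y)) % suc m
toℕ-subₖ x y = toℕ-fromℕ< _

[m%d+n]%d≡[m+n]%d : ∀ m n d .{{_ : NonZero d}} → (m % d + n) % d ≡ (m + n) % d
[m%d+n]%d≡[m+n]%d m n d = begin
  (m % d + n) % d         ≡⟨ %-distribˡ-+ (m % d) n d ⟩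
  (m % d % d + n % d) % d ≡⟨ cong (λ r → (r + n % d) % d) (m%n%n≡m%n m d) ⟩
  (m % d + n % d) % d     ≡⟨ %-distribˡ-+ m n d ⟨
  (m + n) % d             ∎
  where open ≡-Reasoning

subₖ-succₖ : ∀ {m} (x : Fin (2 + m)) → subₖ (succₖ x) x ≡ suc zero
subₖ-succₖ {m} x = toℕ-injective (begin
  toℕ (subₖ (succₖ x) x)                     ≡⟨ toℕ-subₖ (succₖ x) x ⟩
  (toℕ (succₖ x) + toℕ (negₖ x)) % K         ≡⟨ cong₂ (λ u v → (u + v) % K) (toℕ-succₖ x) (toℕ-negₖ _ x) ⟩
  (suc (toℕ x) % K + (K ∸ toℕ x) % K) % K    ≡⟨ %-distribˡ-+ (suc (toℕ x)) (K ∸ toℕ x) K ⟨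
  suc (toℕ x + (K ∸ toℕ x)) % K              ≡⟨ cong (λ r → suc r % K) (m+[n∸m]≡n (toℕ≤n x)) ⟩
  (1 + K) % K                                ≡⟨ [m+n]%n≡m%n 1 K ⟩
  1                                          ∎)
  where
  K = 2 + m
  open ≡-Reasoning

toℕ-iterate-succₖ : ∀ {m} (x : Fin (suc m)) r → toℕ (iterate succₖ x r) ≡ (toℕ x + r) % suc m
toℕ-iterate-succₖ {m} x zero = sym (trans (cong (_% suc m) (+-identityʳ (toℕ x))) (m<n⇒m%n≡m (toℕ<n x)))
toℕ-iterate-succₖ {m} x (suc r) = begin
  toℕ (iterate succₖ (succₖ x) r)   ≡⟨ toℕ-iterate-succₖ (succₖ x) r ⟩
  (toℕ (succₖ x) + r) % suc m       ≡⟨ cong (λ u → (u + r) % suc m) (toℕ-succₖ x) ⟩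
  (suc (toℕ x) % suc m + r) % suc m ≡⟨ [m%d+n]%d≡[m+n]%d (suc (toℕ x)) r (suc m) ⟩
  (suc (toℕ x) + r) % suc m         ≡⟨ cong (_% suc m) (+-suc (toℕ x) r) ⟨
  (toℕ x + suc r) % suc m           ∎
  where open ≡-Reasoning

iterate-succₖ-to-zero : ∀ {m} (x : Fin (suc m)) → iterate succₖ x (suc m ∸ toℕ x) ≡ zero
iterate-succₖ-to-zero {m} x = toℕ-injective (begin
  toℕ (iterate succₖ x (suc m ∸ toℕ x)) ≡⟨ toℕ-iterate-succₖ x (suc m ∸ toℕ x) ⟩
  (toℕ x + (suc m ∸ toℕ x)) % suc m     ≡⟨ cong (_% suc m) (m+[n∸m]≡n (toℕ≤n x)) ⟩
  suc m % suc m                         ≡⟨ n%n≡0 (suc m) ⟩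
  0                                     ∎)
  where open ≡-Reasoning

D-∷ʳ : ∀ {k n} (r : Tuple k (suc n)) y → D (r ∷ʳ y) ≡ D r ∷ʳ subₖ y (last r)
D-∷ʳ (x ∷ [])     y = refl
D-∷ʳ (x ∷ x′ ∷ r) y = cong (subₖ x′ x ∷_) (D-∷ʳ (x′ ∷ r) y)

module _ {q n : ℕ} (Sel : Tuple (3 + q) (suc n) → Set) (Sel⊆H : ∀ c → Sel c → InH c) where
  open ShiftRegister (succₖ {2 + q})

  D-shift : ∀ a (r : Tuple (3 + q) (suc n)) → D (shift (a ∷ r)) ≡ D r ∷ʳ one
  D-shift a r = trans (D-∷ʳ r _) (cong (D r ∷ʳ_) (subₖ-succₖ (last r)))

  DInv-X-shift : ∀ (e : Tuple (3 + q) (2 + n)) → DInv (X Sel) e → DInv (X Sel) (shift e)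
  DInv-X-shift (a ∷ b ∷ r) De∈X =
    subst (X Sel) (sym (D-shift a (b ∷ r))) (X-shift Sel⊆H (subₖ b a) (D (b ∷ r)) De∈X)

  source-shift : ∀ (e : Tuple (3 + q) (2 + n)) → source (shift e) ≡ target e
  source-shift e = init-∷ʳ (succₖ (last e)) (tail e)

  shift-reaches-zero-orbit : ∀ (e : Tuple (3 + q) (2 + n)) →
    Σ ℕ λ m → iterate shift e m ≡ Vec.iterate succₖ zero (2 + n)
  shift-reaches-zero-orbit e = suc n + (3 + q ∸ toℕ (last e)) ,
    trans (iterate-shift e _) (cong (λ c → Vec.iterate succₖ c (2 + n)) (iterate-succₖ-to-zero (last e)))

  DInv-X-connected : ConnectedEdgeSet (DInv (X Sel))
  DInv-X-connected = Flow.connected-if-flows-to (DInv (X Sel)) shift DInv-X-shift source-shift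
    (source (Vec.iterate succₖ zero (2 + n)))
    (λ e _ → let m , reaches = shift-reaches-zero-orbit e in m , cong source reaches)

lemma5p7 : (k n : ℕ) → 3 ≤ k → 3 ≤ n →
    (Sel : Tuple k n → Set) → ValidSelection {k} {n} Sel →
    ConnectedEdgeSet {k} {n} (DInv {k} {n} (X {k} {n} Sel))
lemma5p7 (suc (suc (suc q))) (suc n) (s≤s (s≤s (s≤s z≤n))) (s≤s _) Sel (selected-valid , _) =
  DInv-X-connected Sel (λ c c∈Sel → proj₁ (selected-valid c c∈Sel))
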